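{- Let $Q,R$ be delta operators and $a\in\mathbb K$. Then: (a) $\mathcal E_a Q^{ -1}_{(a)}=0$; (b) for every Appell operator $A$, $(AQ)^{ -1}_{(a)}=Q^{ -1}_{(a)}A^{ -1}$; (c) $Q^{ -1}_{(a)}=R^{ -1}_{(a)}\dfrac{R}{Q}$; (d) $Q/R=QR^{ -1}_{(a)}=QR^{ -1}$.
   Context: $\mathbb K$ is a field of characteristic zero; operators are linear maps on $\mathbb K[x]$; $D=d/dx$, $E^a$ is the shift $f(x)\mapsto f(x+a)$. Shift-invariant operators (commuting with all $E^a$) are formal power series in $D$; an Appell operator is an invertible shift-invariant operator. A delta operator is a shift-invariant $Q$ with $Qx$ a nonzero constant. For a delta operator $Q$, its sigma operator $Q^{ -1}$ is the unique linear operator with $QQ^{ -1}=1$ and $Q^{ -1}Q=1-\mathcal E_0$, where $\mathcal E_a$ sends $f$ to the constant polynomial $f(a)$; set $Q^{ -1}_{(a)}\defeq E^{ -a}Q^{ -1}E^a$ (so $QQ^{ -1}_{(a)}=1$, $Q^{ -1}_{(a)}Q=1-\mathcal E_a$). Operator division: delta operators can be written $Q=DP$, $R=DS$ with $P,S$ invertible shift-invariant, and $Q/R\defeq PS^{ -1}$, $R/Q\defeq SP^{ -1}$. -}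

module Defs where

open import Level using (Level; _⊔_) renaming (suc to lsuc)
open import Algebra.Bundles using (CommutativeRing)
open import Data.Nat using (ℕ; zero; suc)
open import Data.List using (List; []; _∷_; map; foldr; length; upTo)
open import Data.Product using (Σ; ∃; _×_; _,_)
open import Relation.Nullary using (¬_)
open import Function using (_∘_)

record Field (c ℓ : Level) : Set (lsuc (c ⊔ ℓ)) where
  field
    commutativeRing : CommutativeRing c ℓ
  open CommutativeRing commutativeRing public
  field
    1≉0 : ¬ (1# ≈ 0#)
    inverse : ∀ x → ¬ (x ≈ 0#) → ∃ λ y → (x * y) ≈ 1#

module Umbral {c ℓ : Level} (F : Field c ℓ) where
  open Field F

  K : Set c
  K = Carrier

  fromℕ : ℕ → K
  fromℕ zero    = 0#
  fromℕ (suc n) = 1# + fromℕ n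

  CharZero : Set ℓ
  CharZero = ∀ n → ¬ (fromℕ (suc n) ≈ 0#)

  -- Polynomials K[x]: coefficient lists, lowest degree first.
  Poly : Set c
  Poly = List K

  coeff : Poly → ℕ → K
  coeff []       _       = 0#
  coeff (a ∷ p)  zero    = a
  coeff (a ∷ p)  (suc n) = coeff p n

  -- equality of polynomials (equal coefficients; trailing zeros irrelevant)
  _≈ₚ_ : Poly → Poly → Set ℓ
  p ≈ₚ q = ∀ n → coeff p n ≈ coeff q n

  _+ₚ_ : Poly → Poly → Poly
  []      +ₚ q       = q
  (a ∷ p) +ₚ []      = a ∷ p
  (a ∷ p) +ₚ (b ∷ q) = (a + b) ∷ (p +ₚ q)

  scale : K → Poly → Poly
  scale k = map (k *_)

  mulX : Poly → Poly
  mulX p = 0# ∷ p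

  0ₚ : Poly
  0ₚ = []

  const : K → Poly
  const k = k ∷ []

  xₚ : Poly
  xₚ = 0# ∷ 1# ∷ []

  sumₚ : List Poly → Poly
  sumₚ = foldr _+ₚ_ []

  eval : Poly → K → K
  eval []      a = 0#
  eval (b ∷ p) a = b + a * eval p a

  derivFrom : ℕ → Poly → Poly
  derivFrom n []      = []
  derivFrom n (b ∷ p) = (fromℕ n * b) ∷ derivFrom (suc n) p

  D : Poly → Poly
  D []      = []
  D (b ∷ p) = derivFrom 1 p

  Dⁿ : ℕ → Poly → Poly
  Dⁿ zero    f = f
  Dⁿ (suc k) f = D (Dⁿ k f)

  -- shift E^a : f(x) ↦ f(x + a)   (Horner: b + (x + a) * f(x+a))
  E : K → Poly → Poly
  E a []      = []
  E a (b ∷ p) = const b +ₚ (mulX (E a p) +ₚ scale a (E a p))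

  𝓔 : K → Poly → Poly
  𝓔 a f = const (eval f a)

  Op : Set c
  Op = Poly → Poly

  _≈ₒ_ : Op → Op → Set (c ⊔ ℓ)
  S ≈ₒ T = ∀ f → S f ≈ₚ T f

  idₒ : Op
  idₒ f = f

  _-ₒ_ : Op → Op → Op
  (S -ₒ T) f = S f +ₚ scale (- 1#) (T f)

  0ₒ : Op
  0ₒ f = 0ₚ

  record IsLinear (S : Op) : Set (c ⊔ ℓ) where
    field
      cong  : ∀ f g → f ≈ₚ g → S f ≈ₚ S g
      additive : ∀ f g → S (f +ₚ g) ≈ₚ (S f +ₚ S g)
      homogeneous : ∀ k f → S (scale k f) ≈ₚ scale k (S f)

  -- Shift-invariant operators = formal power series in D, Σ c_k D^k.
  Series : Set c
  Series = ℕ → K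

  -- action of Σ c_k D^k on f (D^k f = 0 for k > length f)
  ⟦_⟧ : Series → Op
  ⟦ s ⟧ f = sumₚ (map (λ k → scale (s k) (Dⁿ k f)) (upTo (suc (length f))))

  IsDelta : Series → Set (c ⊔ ℓ)
  IsDelta Q = ∃ λ k → ¬ (k ≈ 0#) × (⟦ Q ⟧ xₚ ≈ₚ const k)

  IsInverse : Series → Series → Set (c ⊔ ℓ)
  IsInverse A B = ((⟦ A ⟧ ∘ ⟦ B ⟧) ≈ₒ idₒ) × ((⟦ B ⟧ ∘ ⟦ A ⟧) ≈ₒ idₒ)

  IsAppell : Series → Set (c ⊔ ℓ)
  IsAppell A = ∃ λ B → IsInverse A B

  -- S is the sigma operator Q⁻¹ of the operator Q (Q is a delta operator):
  -- S linear, Q S = 1, S Q = 1 - 𝓔₀.  (It is unique.)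
  record IsSigma (Q : Op) (S : Op) : Set (c ⊔ ℓ) where
    field
      linear : IsLinear S
      right  : (Q ∘ S) ≈ₒ idₒ
      left   : (S ∘ Q) ≈ₒ (idₒ -ₒ 𝓔 0#)

  -- Q⁻¹_(a) = E^{-a} Q⁻¹ E^a
  conj : K → Op → Op
  conj a S = E (- a) ∘ S ∘ E a

  -- Q = D P with P = Σ q_{k+1} D^k
  quotD : Series → Series
  quotD Q k = Q (suc k)

  -- Q / R = P S⁻¹ where Q = D P, R = D S and Sinv is the inverse of S
  divide : Series → Series → Op
  divide Q Sinv = ⟦ quotD Q ⟧ ∘ ⟦ Sinv ⟧

{-# OPTIONS --safe #-}
-- Two facts about the sigma operator M⁻¹ of an operator M carry the argument:
-- (M⁻¹ h)(0) = 0, and M⁻¹ is the only right inverse T of M with (T h)(0) = 0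
-- (apply M⁻¹ to M T h = h and use M⁻¹ M = 1 - 𝓔₀).  So a claimed formula for
-- a sigma operator is verified by applying M to it.  A delta operator has no
-- constant term, so R = S D with S = quotD R; hence D R⁻¹ = S⁻¹ and
-- Q R⁻¹ = P D R⁻¹ = P S⁻¹ = Q/R.  Series in D commute with every shift, so
-- conjugating by E^a reduces (b)-(d) to these unshifted identities, while (a)
-- is (M⁻¹ h)(0) = 0 read at the shifted point.
module Submission where

open import Defs
open import Level using (Level; _⊔_)
open import Data.Product using (_×_; _,_)
open import Function using (_∘_)
open import Data.Nat as ℕ using (ℕ; zero; suc; z≤n; s≤s)
import Data.Nat.Properties as ℕ
open import Data.List using ([]; _∷_; length; map; applyUpTo)
import Relation.Binary.PropositionalEquality as ≡
open import Relation.Binary.Bundles using (Setoid)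
import Relation.Binary.Reasoning.Setoid as SetoidReasoning
import Algebra.Properties.AbelianGroup as AbelianGroupProperties
import Algebra.Properties.Ring as RingProperties
import Algebra.Properties.CommutativeSemigroup as CommutativeSemigroupProperties

module UmbralProperties {c ℓ : Level} (F : Field c ℓ) where
  open Field F hiding (zero)
  open Umbral F
  open AbelianGroupProperties +-abelianGroup using (identityʳ-unique; ⁻¹-injective; ε⁻¹≈ε)
  open RingProperties ring using (-1*x≈-x)
  open CommutativeSemigroupProperties *-commutativeSemigroup using (x∙yz≈y∙xz)
  open CommutativeSemigroupProperties +-commutativeSemigroup using ()
    renaming (interchange to +-interchange)

  module ≈-Reasoning = SetoidReasoning setoid

  -- _≈ₚ_ is a Π-type over the coefficients, so its two sides cannot be
  -- inferred from it; wrapping it in a record makes them inferable.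
  infix 4 _≋_
  record _≋_ (p q : Poly) : Set ℓ where
    constructor mk≋
    field coeff-≈ : p ≈ₚ q
  open _≋_

  ≋-setoid : Setoid c ℓ
  ≋-setoid = record
    { Carrier       = Poly
    ; _≈_           = _≋_
    ; isEquivalence = record
      { refl  = mk≋ λ _ → refl
      ; sym   = λ (mk≋ p≈q) → mk≋ λ n → sym (p≈q n)
      ; trans = λ (mk≋ p≈q) (mk≋ q≈r) → mk≋ λ n → trans (p≈q n) (q≈r n)
      }
    }

  open Setoid ≋-setoid using () renaming (refl to ≋-refl; sym to ≋-sym; trans to ≋-trans)
  module ≋-Reasoning = SetoidReasoning ≋-setoid

  ≡⇒≋ : ∀ {p q} → p ≡.≡ q → p ≋ q
  ≡⇒≋ ≡.refl = ≋-refl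

  coeff-+ₚ : ∀ p q n → coeff (p +ₚ q) n ≈ coeff p n + coeff q n
  coeff-+ₚ []      q       n       = sym (+-identityˡ _)
  coeff-+ₚ (a ∷ p) []      n       = sym (+-identityʳ _)
  coeff-+ₚ (a ∷ p) (b ∷ q) zero    = refl
  coeff-+ₚ (a ∷ p) (b ∷ q) (suc n) = coeff-+ₚ p q n

  coeff-scale : ∀ k p n → coeff (scale k p) n ≈ k * coeff p n
  coeff-scale k []      n       = sym (zeroʳ k)
  coeff-scale k (a ∷ p) zero    = refl
  coeff-scale k (a ∷ p) (suc n) = coeff-scale k p n

  coeff-derivFrom : ∀ m p n → coeff (derivFrom m p) n ≈ fromℕ (m ℕ.+ n) * coeff p n
  coeff-derivFrom m []      n       = sym (zeroʳ _)
  coeff-derivFrom m (b ∷ p) zero    rewrite ℕ.+-identityʳ m = refl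
  coeff-derivFrom m (b ∷ p) (suc n) rewrite ℕ.+-suc m n = coeff-derivFrom (suc m) p n

  coeff-D : ∀ p n → coeff (D p) n ≈ fromℕ (suc n) * coeff p (suc n)
  coeff-D []      n = sym (zeroʳ _)
  coeff-D (b ∷ p) n = coeff-derivFrom 1 p n

  +ₚ-cong : ∀ {p p′ q q′} → p ≋ p′ → q ≋ q′ → p +ₚ q ≋ p′ +ₚ q′
  +ₚ-cong {p} {p′} {q} {q′} (mk≋ p≈p′) (mk≋ q≈q′) = mk≋ λ n →
    trans (coeff-+ₚ p q n) (trans (+-cong (p≈p′ n) (q≈q′ n)) (sym (coeff-+ₚ p′ q′ n)))

  +ₚ-congˡ : ∀ p {q q′} → q ≋ q′ → p +ₚ q ≋ p +ₚ q′
  +ₚ-congˡ p = +ₚ-cong {p} ≋-refl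

  scale-cong : ∀ {k k′ p p′} → k ≈ k′ → p ≋ p′ → scale k p ≋ scale k′ p′
  scale-cong {k} {k′} {p} {p′} k≈k′ (mk≋ p≈p′) = mk≋ λ n →
    trans (coeff-scale k p n) (trans (*-cong k≈k′ (p≈p′ n)) (sym (coeff-scale k′ p′ n)))

  mulX-cong : ∀ {p q} → p ≋ q → mulX p ≋ mulX q
  mulX-cong (mk≋ p≈q) = mk≋ λ { zero → refl ; (suc n) → p≈q n }

  const-cong : ∀ {a b} → a ≈ b → const a ≋ const b
  const-cong a≈b = mk≋ λ { zero → a≈b ; (suc n) → refl }

  D-cong : ∀ {p q} → p ≋ q → D p ≋ D q
  D-cong {p} {q} (mk≋ p≈q) = mk≋ λ n →
    trans (coeff-D p n) (trans (*-congˡ (p≈q (suc n))) (sym (coeff-D q n)))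

  Dⁿ-cong : ∀ k {p q} → p ≋ q → Dⁿ k p ≋ Dⁿ k q
  Dⁿ-cong zero    p≋q = p≋q
  Dⁿ-cong (suc k) p≋q = D-cong (Dⁿ-cong k p≋q)

  +ₚ-identityʳ : ∀ p → p +ₚ [] ≋ p
  +ₚ-identityʳ []      = ≋-refl
  +ₚ-identityʳ (a ∷ p) = ≋-refl

  const≈0 : ∀ {e} → e ≈ 0# → const e ≋ []
  const≈0 e≈0 = mk≋ λ { zero → e≈0 ; (suc n) → refl }

  const0-+ₚ : ∀ p → const 0# +ₚ p ≋ p
  const0-+ₚ p = +ₚ-cong {const 0#} {[]} (const≈0 refl) ≋-refl

  +ₚ-const≈0 : ∀ p {e} → e ≈ 0# → p +ₚ const e ≋ p
  +ₚ-const≈0 p e≈0 = ≋-trans (+ₚ-congˡ p (const≈0 e≈0)) (+ₚ-identityʳ p)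

  scale-zeroˡ : ∀ p → scale 0# p ≋ []
  scale-zeroˡ p = mk≋ λ n → trans (coeff-scale 0# p n) (zeroˡ _)

  +ₚ-assoc : ∀ p q r → (p +ₚ q) +ₚ r ≋ p +ₚ (q +ₚ r)
  +ₚ-assoc p q r = mk≋ λ n → begin
    coeff ((p +ₚ q) +ₚ r) n
      ≈⟨ trans (coeff-+ₚ (p +ₚ q) r n) (+-congʳ (coeff-+ₚ p q n)) ⟩
    (coeff p n + coeff q n) + coeff r n
      ≈⟨ +-assoc _ _ _ ⟩
    coeff p n + (coeff q n + coeff r n)
      ≈⟨ sym (trans (coeff-+ₚ p (q +ₚ r) n) (+-congˡ (coeff-+ₚ q r n))) ⟩
    coeff (p +ₚ (q +ₚ r)) n
      ∎
    where open ≈-Reasoning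

  scale-+ₚ : ∀ k p q → scale k (p +ₚ q) ≋ scale k p +ₚ scale k q
  scale-+ₚ k p q = mk≋ λ n → begin
    coeff (scale k (p +ₚ q)) n
      ≈⟨ trans (coeff-scale k (p +ₚ q) n) (*-congˡ (coeff-+ₚ p q n)) ⟩
    k * (coeff p n + coeff q n)
      ≈⟨ distribˡ k _ _ ⟩
    k * coeff p n + k * coeff q n
      ≈⟨ sym (trans (coeff-+ₚ (scale k p) (scale k q) n) (+-cong (coeff-scale k p n) (coeff-scale k q n))) ⟩
    coeff (scale k p +ₚ scale k q) n
      ∎
    where open ≈-Reasoning

  scale-neg-+ₚ-scale : ∀ k p → scale (- k) p +ₚ scale k p ≋ []
  scale-neg-+ₚ-scale k p = mk≋ λ n → begin
    coeff (scale (- k) p +ₚ scale k p) n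
      ≈⟨ trans (coeff-+ₚ (scale (- k) p) (scale k p) n) (+-cong (coeff-scale (- k) p n) (coeff-scale k p n)) ⟩
    - k * coeff p n + k * coeff p n
      ≈⟨ sym (distribʳ _ (- k) k) ⟩
    (- k + k) * coeff p n
      ≈⟨ trans (*-congʳ (-‿inverseˡ k)) (zeroˡ _) ⟩
    0#
      ∎
    where open ≈-Reasoning

  cons≋const+mulX : ∀ b p → b ∷ p ≋ const b +ₚ mulX p
  cons≋const+mulX b p = mk≋ λ { zero → sym (+-identityʳ b) ; (suc n) → refl }

  D-+ₚ : ∀ p q → D (p +ₚ q) ≋ D p +ₚ D q
  D-+ₚ p q = mk≋ λ n → begin
    coeff (D (p +ₚ q)) n
      ≈⟨ trans (coeff-D (p +ₚ q) n) (*-congˡ (coeff-+ₚ p q (suc n))) ⟩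
    fromℕ (suc n) * (coeff p (suc n) + coeff q (suc n))
      ≈⟨ distribˡ _ _ _ ⟩
    fromℕ (suc n) * coeff p (suc n) + fromℕ (suc n) * coeff q (suc n)
      ≈⟨ sym (trans (coeff-+ₚ (D p) (D q) n) (+-cong (coeff-D p n) (coeff-D q n))) ⟩
    coeff (D p +ₚ D q) n
      ∎
    where open ≈-Reasoning

  D-scale : ∀ k p → D (scale k p) ≋ scale k (D p)
  D-scale k p = mk≋ λ n → begin
    coeff (D (scale k p)) n
      ≈⟨ trans (coeff-D (scale k p) n) (*-congˡ (coeff-scale k p (suc n))) ⟩
    fromℕ (suc n) * (k * coeff p (suc n))
      ≈⟨ x∙yz≈y∙xz _ _ _ ⟩
    k * (fromℕ (suc n) * coeff p (suc n))
      ≈⟨ sym (trans (coeff-scale k (D p) n) (*-congˡ (coeff-D p n))) ⟩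
    coeff (scale k (D p)) n
      ∎
    where open ≈-Reasoning

  D-mulX : ∀ q → D (mulX q) ≋ q +ₚ mulX (D q)
  D-mulX q = mk≋ λ n → trans (coeff-D (mulX q) n) (sym (trans (coeff-+ₚ q (mulX (D q)) n) (coeffs n)))
    where
    open ≈-Reasoning
    coeffs : ∀ n → coeff q n + coeff (mulX (D q)) n ≈ fromℕ (suc n) * coeff q n
    coeffs zero = begin
      coeff q 0 + 0#          ≈⟨ +-identityʳ _ ⟩
      coeff q 0               ≈⟨ sym (*-identityˡ _) ⟩
      1# * coeff q 0          ≈⟨ *-congʳ (sym (+-identityʳ 1#)) ⟩
      (1# + 0#) * coeff q 0   ∎
    coeffs (suc m) = begin
      coeff q (suc m) + coeff (D q) m
        ≈⟨ +-cong (sym (*-identityˡ _)) (coeff-D q m) ⟩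
      1# * coeff q (suc m) + fromℕ (suc m) * coeff q (suc m)
        ≈⟨ sym (distribʳ _ _ _) ⟩
      (1# + fromℕ (suc m)) * coeff q (suc m)
        ∎

  +ₚ-interchange : ∀ p q r s → (p +ₚ q) +ₚ (r +ₚ s) ≋ (p +ₚ r) +ₚ (q +ₚ s)
  +ₚ-interchange p q r s = mk≋ λ n → begin
    coeff ((p +ₚ q) +ₚ (r +ₚ s)) n
      ≈⟨ trans (coeff-+ₚ (p +ₚ q) (r +ₚ s) n) (+-cong (coeff-+ₚ p q n) (coeff-+ₚ r s n)) ⟩
    (coeff p n + coeff q n) + (coeff r n + coeff s n)
      ≈⟨ +-interchange _ _ _ _ ⟩
    (coeff p n + coeff r n) + (coeff q n + coeff s n)
      ≈⟨ sym (trans (coeff-+ₚ (p +ₚ r) (q +ₚ s) n) (+-cong (coeff-+ₚ p r n) (coeff-+ₚ q s n))) ⟩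
    coeff ((p +ₚ r) +ₚ (q +ₚ s)) n
      ∎
    where open ≈-Reasoning

  scale-comm : ∀ k l p → scale k (scale l p) ≋ scale l (scale k p)
  scale-comm k l p = mk≋ λ n → begin
    coeff (scale k (scale l p)) n ≈⟨ trans (coeff-scale k (scale l p) n) (*-congˡ (coeff-scale l p n)) ⟩
    k * (l * coeff p n)           ≈⟨ x∙yz≈y∙xz k l _ ⟩
    l * (k * coeff p n)           ≈⟨ sym (trans (coeff-scale l (scale k p) n) (*-congˡ (coeff-scale k p n))) ⟩
    coeff (scale l (scale k p)) n ∎
    where open ≈-Reasoning

  mulX-+ₚ : ∀ p q → mulX (p +ₚ q) ≋ mulX p +ₚ mulX q
  mulX-+ₚ p q = mk≋ λ { zero → sym (+-identityˡ 0#) ; (suc n) → refl }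

  mulX-scale : ∀ k p → mulX (scale k p) ≋ scale k (mulX p)
  mulX-scale k p = mk≋ λ { zero → sym (zeroʳ k) ; (suc n) → refl }

  shiftStep : K → K → Poly → Poly
  shiftStep a b p = const b +ₚ (mulX p +ₚ scale a p)

  shiftStep-cong : ∀ a {b b′ p p′} → b ≈ b′ → p ≋ p′ → shiftStep a b p ≋ shiftStep a b′ p′
  shiftStep-cong a b≈b′ p≋p′ =
    +ₚ-cong (const-cong b≈b′) (+ₚ-cong (mulX-cong p≋p′) (scale-cong refl p≋p′))

  shiftStep-+ : ∀ a b b′ p p′ →
                shiftStep a (b + b′) (p +ₚ p′) ≋ shiftStep a b p +ₚ shiftStep a b′ p′
  shiftStep-+ a b b′ p p′ = begin
    const (b + b′) +ₚ (mulX (p +ₚ p′) +ₚ scale a (p +ₚ p′))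
      ≈⟨ +ₚ-congˡ (const (b + b′)) (+ₚ-cong (mulX-+ₚ p p′) (scale-+ₚ a p p′)) ⟩
    (const b +ₚ const b′) +ₚ ((mulX p +ₚ mulX p′) +ₚ (scale a p +ₚ scale a p′))
      ≈⟨ +ₚ-congˡ (const b +ₚ const b′) (+ₚ-interchange (mulX p) (mulX p′) (scale a p) (scale a p′)) ⟩
    (const b +ₚ const b′) +ₚ ((mulX p +ₚ scale a p) +ₚ (mulX p′ +ₚ scale a p′))
      ≈⟨ +ₚ-interchange (const b) (const b′) (mulX p +ₚ scale a p) (mulX p′ +ₚ scale a p′) ⟩
    shiftStep a b p +ₚ shiftStep a b′ p′
      ∎
    where open ≋-Reasoning

  shiftStep-scale : ∀ a k b p → shiftStep a (k * b) (scale k p) ≋ scale k (shiftStep a b p)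
  shiftStep-scale a k b p = begin
    const (k * b) +ₚ (mulX (scale k p) +ₚ scale a (scale k p))
      ≈⟨ +ₚ-congˡ (const (k * b)) (+ₚ-cong (mulX-scale k p) (scale-comm a k p)) ⟩
    scale k (const b) +ₚ (scale k (mulX p) +ₚ scale k (scale a p))
      ≈⟨ +ₚ-congˡ (scale k (const b)) (≋-sym (scale-+ₚ k (mulX p) (scale a p))) ⟩
    scale k (const b) +ₚ scale k (mulX p +ₚ scale a p)
      ≈⟨ ≋-sym (scale-+ₚ k (const b) (mulX p +ₚ scale a p)) ⟩
    scale k (shiftStep a b p)
      ∎
    where open ≋-Reasoning

  E-≋[] : ∀ a p → p ≋ [] → E a p ≋ []
  E-≋[] a []      _              = ≋-refl
  E-≋[] a (b ∷ p) (mk≋ b∷p≈[]) = begin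
    shiftStep a b (E a p)  ≈⟨ shiftStep-cong a (b∷p≈[] 0) (E-≋[] a p (mk≋ {p} (b∷p≈[] ∘ suc))) ⟩
    shiftStep a 0# []      ≈⟨ const≈0 (+-identityˡ 0#) ⟩
    []                     ∎
    where open ≋-Reasoning

  E-cong : ∀ a {p q} → p ≋ q → E a p ≋ E a q
  E-cong a {[]}    {q}     p≋q         = ≋-sym (E-≋[] a q (≋-sym p≋q))
  E-cong a {b ∷ p} {[]}    p≋q         = E-≋[] a (b ∷ p) p≋q
  E-cong a {b ∷ p} {b′ ∷ q} (mk≋ p≈q) =
    shiftStep-cong a (p≈q 0) (E-cong a {p} {q} (mk≋ (p≈q ∘ suc)))

  E-+ₚ : ∀ a p q → E a (p +ₚ q) ≋ E a p +ₚ E a q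
  E-+ₚ a []      q       = ≋-refl
  E-+ₚ a (b ∷ p) []      = ≋-sym (+ₚ-identityʳ _)
  E-+ₚ a (b ∷ p) (b′ ∷ q) =
    ≋-trans (shiftStep-cong a refl (E-+ₚ a p q)) (shiftStep-+ a b b′ (E a p) (E a q))

  E-scale : ∀ a k p → E a (scale k p) ≋ scale k (E a p)
  E-scale a k []      = ≋-refl
  E-scale a k (b ∷ p) = ≋-trans (shiftStep-cong a refl (E-scale a k p)) (shiftStep-scale a k b (E a p))

  E-const : ∀ a b → E a (const b) ≋ const b
  E-const a b = mk≋ λ { zero → +-identityʳ b ; (suc n) → refl }

  E-mulX : ∀ a p → E a (mulX p) ≋ mulX (E a p) +ₚ scale a (E a p)
  E-mulX a p = const0-+ₚ _

  E-inverse : ∀ a p → E (- a) (E a p) ≋ p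
  E-inverse a []      = ≋-refl
  E-inverse a (b ∷ p) = begin
    E (- a) (const b +ₚ (mulX q +ₚ scale a q))
      ≈⟨ E-+ₚ (- a) (const b) (mulX q +ₚ scale a q) ⟩
    E (- a) (const b) +ₚ E (- a) (mulX q +ₚ scale a q)
      ≈⟨ +ₚ-cong (E-const (- a) b) (E-+ₚ (- a) (mulX q) (scale a q)) ⟩
    const b +ₚ (E (- a) (mulX q) +ₚ E (- a) (scale a q))
      ≈⟨ +ₚ-congˡ (const b) (+ₚ-cong (E-mulX (- a) q) (E-scale (- a) a q)) ⟩
    const b +ₚ ((mulX r +ₚ scale (- a) r) +ₚ scale a r)
      ≈⟨ +ₚ-congˡ (const b) (+ₚ-assoc (mulX r) (scale (- a) r) (scale a r)) ⟩
    const b +ₚ (mulX r +ₚ (scale (- a) r +ₚ scale a r))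
      ≈⟨ +ₚ-congˡ (const b) (+ₚ-congˡ (mulX r) (scale-neg-+ₚ-scale a r)) ⟩
    const b +ₚ (mulX r +ₚ [])
      ≈⟨ +ₚ-congˡ (const b) (+ₚ-identityʳ (mulX r)) ⟩
    const b +ₚ mulX r
      ≈⟨ +ₚ-congˡ (const b) (mulX-cong (E-inverse a p)) ⟩
    const b +ₚ mulX p
      ≈⟨ ≋-sym (cons≋const+mulX b p) ⟩
    b ∷ p
      ∎
    where
    open ≋-Reasoning
    q = E a p
    r = E (- a) q

  D-E : ∀ a p → D (E a p) ≋ E a (D p)
  D-E a []      = ≋-refl
  D-E a (b ∷ p) = begin
    D (const b +ₚ (mulX q +ₚ scale a q))
      ≈⟨ ≋-trans (D-+ₚ (const b) (mulX q +ₚ scale a q)) (D-+ₚ (mulX q) (scale a q)) ⟩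
    D (mulX q) +ₚ D (scale a q)
      ≈⟨ +ₚ-cong (D-mulX q) (D-scale a q) ⟩
    (q +ₚ mulX (D q)) +ₚ scale a (D q)
      ≈⟨ +ₚ-assoc q (mulX (D q)) (scale a (D q)) ⟩
    q +ₚ (mulX (D q) +ₚ scale a (D q))
      ≈⟨ +ₚ-congˡ q (+ₚ-cong (mulX-cong (D-E a p)) (scale-cong refl (D-E a p))) ⟩
    q +ₚ (mulX (E a (D p)) +ₚ scale a (E a (D p)))
      ≈⟨ +ₚ-congˡ q (≋-sym (E-mulX a (D p))) ⟩
    E a p +ₚ E a (mulX (D p))
      ≈⟨ ≋-sym (E-+ₚ a p (mulX (D p))) ⟩
    E a (p +ₚ mulX (D p))
      ≈⟨ E-cong a (≋-sym (D-mulX p)) ⟩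
    E a (D (b ∷ p))
      ∎
    where
    open ≋-Reasoning
    q = E a p

  Dⁿ-E : ∀ a k p → Dⁿ k (E a p) ≋ E a (Dⁿ k p)
  Dⁿ-E a zero    p = ≋-refl
  Dⁿ-E a (suc k) p = ≋-trans (D-cong (Dⁿ-E a k p)) (D-E a (Dⁿ k p))

  eval-+ₚ : ∀ p q x → eval (p +ₚ q) x ≈ eval p x + eval q x
  eval-+ₚ []      q       x = sym (+-identityˡ _)
  eval-+ₚ (b ∷ p) []      x = sym (+-identityʳ _)
  eval-+ₚ (b ∷ p) (c ∷ q) x = begin
    (b + c) + x * eval (p +ₚ q) x         ≈⟨ +-congˡ (trans (*-congˡ (eval-+ₚ p q x)) (distribˡ x _ _)) ⟩
    (b + c) + (x * eval p x + x * eval q x) ≈⟨ +-interchange b c _ _ ⟩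
    (b + x * eval p x) + (c + x * eval q x) ∎
    where open ≈-Reasoning

  eval-scale : ∀ k p x → eval (scale k p) x ≈ k * eval p x
  eval-scale k []      x = sym (zeroʳ k)
  eval-scale k (b ∷ p) x = begin
    k * b + x * eval (scale k p) x ≈⟨ +-congˡ (trans (*-congˡ (eval-scale k p x)) (x∙yz≈y∙xz x k _)) ⟩
    k * b + k * (x * eval p x)     ≈⟨ sym (distribˡ k b _) ⟩
    k * (b + x * eval p x)         ∎
    where open ≈-Reasoning

  eval-cong : ∀ p {x y} → x ≈ y → eval p x ≈ eval p y
  eval-cong []      x≈y = refl
  eval-cong (b ∷ p) x≈y = +-congˡ (*-cong x≈y (eval-cong p x≈y))

  eval-E : ∀ a p x → eval (E a p) x ≈ eval p (x + a)
  eval-E a []      x = refl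
  eval-E a (b ∷ p) x = begin
    eval (const b +ₚ (mulX q +ₚ scale a q)) x
      ≈⟨ eval-+ₚ (const b) (mulX q +ₚ scale a q) x ⟩
    eval (const b) x + eval (mulX q +ₚ scale a q) x
      ≈⟨ +-congˡ (trans (eval-+ₚ (mulX q) (scale a q) x) (+-congˡ (eval-scale a q x))) ⟩
    (b + x * 0#) + ((0# + x * eval q x) + a * eval q x)
      ≈⟨ +-cong (trans (+-congˡ (zeroʳ x)) (+-identityʳ b))
                (trans (+-congʳ (+-identityˡ _)) (sym (distribʳ _ x a))) ⟩
    b + (x + a) * eval q x
      ≈⟨ +-congˡ (*-congˡ (eval-E a p x)) ⟩
    b + (x + a) * eval p (x + a)
      ∎
    where
    open ≈-Reasoning
    q = E a p

  length-derivFrom : ∀ m p → length (derivFrom m p) ≡.≡ length p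
  length-derivFrom m []      = ≡.refl
  length-derivFrom m (b ∷ p) = ≡.cong suc (length-derivFrom (suc m) p)

  length-D : ∀ p → length (D p) ≡.≡ ℕ.pred (length p)
  length-D []      = ≡.refl
  length-D (b ∷ p) = length-derivFrom 1 p

  Dⁿ-suc : ∀ k p → Dⁿ (suc k) p ≡.≡ Dⁿ k (D p)
  Dⁿ-suc zero    p = ≡.refl
  Dⁿ-suc (suc k) p = ≡.cong D (Dⁿ-suc k p)

  Dⁿ-≡[] : ∀ k p → length p ℕ.≤ k → Dⁿ k p ≡.≡ []
  Dⁿ-≡[] zero    []  _       = ≡.refl
  Dⁿ-≡[] (suc k) p p≤1+k = ≡.trans (Dⁿ-suc k p) (Dⁿ-≡[] k (D p) Dp≤k)
    where
    Dp≤k : length (D p) ℕ.≤ k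
    Dp≤k = ℕ.≤-trans (ℕ.≤-reflexive (length-D p)) (ℕ.pred-mono-≤ p≤1+k)

  sumBelow : (ℕ → Poly) → ℕ → Poly
  sumBelow g zero    = []
  sumBelow g (suc N) = g 0 +ₚ sumBelow (g ∘ suc) N

  sumₚ-map-applyUpTo : ∀ (g : ℕ → Poly) h N → sumₚ (map g (applyUpTo h N)) ≡.≡ sumBelow (g ∘ h) N
  sumₚ-map-applyUpTo g h zero    = ≡.refl
  sumₚ-map-applyUpTo g h (suc N) = ≡.cong (g (h 0) +ₚ_) (sumₚ-map-applyUpTo g (h ∘ suc) N)

  sumBelow-cong : ∀ {g g′} N → (∀ k → g k ≋ g′ k) → sumBelow g N ≋ sumBelow g′ N
  sumBelow-cong zero    g≋g′ = ≋-refl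
  sumBelow-cong (suc N) g≋g′ = +ₚ-cong (g≋g′ 0) (sumBelow-cong N (g≋g′ ∘ suc))

  sumBelow-≋[] : ∀ g N → (∀ k → g k ≋ []) → sumBelow g N ≋ []
  sumBelow-≋[] g zero    g≋[] = ≋-refl
  sumBelow-≋[] g (suc N) g≋[] = +ₚ-cong (g≋[] 0) (sumBelow-≋[] (g ∘ suc) N (g≋[] ∘ suc))

  sumBelow-truncate : ∀ g M N → (∀ k → M ℕ.≤ k → g k ≋ []) → M ℕ.≤ N → sumBelow g N ≋ sumBelow g M
  sumBelow-truncate g zero    N       g≋[] _         = sumBelow-≋[] g N (λ k → g≋[] k z≤n)
  sumBelow-truncate g (suc M) (suc N) g≋[] (s≤s M≤N) =
    +ₚ-congˡ (g 0) (sumBelow-truncate (g ∘ suc) M N (λ k M≤k → g≋[] (suc k) (s≤s M≤k)) M≤N)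

  E-sumBelow : ∀ a g N → E a (sumBelow g N) ≋ sumBelow (E a ∘ g) N
  E-sumBelow a g zero    = ≋-refl
  E-sumBelow a g (suc N) =
    ≋-trans (E-+ₚ a (g 0) (sumBelow (g ∘ suc) N)) (+ₚ-congˡ (E a (g 0)) (E-sumBelow a (g ∘ suc) N))

  record Congruent (T : Op) : Set (c ⊔ ℓ) where
    field ≋-cong : ∀ {f g} → f ≋ g → T f ≋ T g
  open Congruent

  record ShiftInvariant (T : Op) : Set (c ⊔ ℓ) where
    field E-comm : ∀ a f → T (E a f) ≋ E a (T f)
  open ShiftInvariant

  ShiftInvariant-∘ : ∀ {S T} → Congruent S → ShiftInvariant S → ShiftInvariant T → ShiftInvariant (S ∘ T)
  ShiftInvariant-∘ S-cong S-inv T-inv .E-comm a f =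
    ≋-trans (≋-cong S-cong (E-comm T-inv a f)) (E-comm S-inv a _)

  seriesTerm : Series → Poly → ℕ → Poly
  seriesTerm s f k = scale (s k) (Dⁿ k f)

  ⟦⟧-sumBelow : ∀ s f N → length f ℕ.≤ N → ⟦ s ⟧ f ≋ sumBelow (seriesTerm s f) N
  ⟦⟧-sumBelow s f N f≤N = begin
    ⟦ s ⟧ f
      ≈⟨ ≡⇒≋ (sumₚ-map-applyUpTo (seriesTerm s f) (λ k → k) (suc (length f))) ⟩
    sumBelow (seriesTerm s f) (suc (length f))
      ≈⟨ sumBelow-truncate (seriesTerm s f) (length f) (suc (length f)) vanish (ℕ.n≤1+n _) ⟩
    sumBelow (seriesTerm s f) (length f)
      ≈⟨ ≋-sym (sumBelow-truncate (seriesTerm s f) (length f) N vanish f≤N) ⟩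
    sumBelow (seriesTerm s f) N
      ∎
    where
    open ≋-Reasoning
    vanish : ∀ k → length f ℕ.≤ k → seriesTerm s f k ≋ []
    vanish k f≤k = ≡⇒≋ (≡.cong (scale (s k)) (Dⁿ-≡[] k f f≤k))

  ⟦⟧-cong : ∀ s {f g} → f ≋ g → ⟦ s ⟧ f ≋ ⟦ s ⟧ g
  ⟦⟧-cong s {f} {g} f≋g = begin
    ⟦ s ⟧ f                     ≈⟨ ⟦⟧-sumBelow s f N (ℕ.m≤m+n _ _) ⟩
    sumBelow (seriesTerm s f) N ≈⟨ sumBelow-cong N (λ k → scale-cong refl (Dⁿ-cong k f≋g)) ⟩
    sumBelow (seriesTerm s g) N ≈⟨ ≋-sym (⟦⟧-sumBelow s g N (ℕ.m≤n+m _ _)) ⟩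
    ⟦ s ⟧ g                     ∎
    where
    open ≋-Reasoning
    N = length f ℕ.+ length g

  ⟦⟧-E : ∀ s a f → ⟦ s ⟧ (E a f) ≋ E a (⟦ s ⟧ f)
  ⟦⟧-E s a f = begin
    ⟦ s ⟧ (E a f)                        ≈⟨ ⟦⟧-sumBelow s (E a f) N (ℕ.m≤n+m _ _) ⟩
    sumBelow (seriesTerm s (E a f)) N    ≈⟨ sumBelow-cong N E-term ⟩
    sumBelow (E a ∘ seriesTerm s f) N    ≈⟨ ≋-sym (E-sumBelow a (seriesTerm s f) N) ⟩
    E a (sumBelow (seriesTerm s f) N)    ≈⟨ E-cong a (≋-sym (⟦⟧-sumBelow s f N (ℕ.m≤m+n _ _))) ⟩
    E a (⟦ s ⟧ f)                        ∎
    where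
    open ≋-Reasoning
    N = length f ℕ.+ length (E a f)
    E-term : ∀ k → seriesTerm s (E a f) k ≋ E a (seriesTerm s f k)
    E-term k = ≋-trans (scale-cong refl (Dⁿ-E a k f)) (≋-sym (E-scale a (s k) (Dⁿ k f)))

  ⟦⟧-quotD : ∀ Q → Q 0 ≈ 0# → ∀ g → ⟦ Q ⟧ g ≋ ⟦ quotD Q ⟧ (D g)
  ⟦⟧-quotD Q Q0≈0 g = begin
    ⟦ Q ⟧ g
      ≈⟨ ⟦⟧-sumBelow Q g (suc L) (ℕ.n≤1+n L) ⟩
    scale (Q 0) g +ₚ sumBelow (seriesTerm Q g ∘ suc) L
      ≈⟨ +ₚ-cong (≋-trans (scale-cong Q0≈0 ≋-refl) (scale-zeroˡ g)) (sumBelow-cong L Dⁿ-suc-term) ⟩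
    sumBelow (seriesTerm (quotD Q) (D g)) L
      ≈⟨ ≋-sym (⟦⟧-sumBelow (quotD Q) (D g) L (ℕ.≤-trans (ℕ.≤-reflexive (length-D g)) ℕ.pred[n]≤n)) ⟩
    ⟦ quotD Q ⟧ (D g)
      ∎
    where
    open ≋-Reasoning
    L = length g
    Dⁿ-suc-term : ∀ k → seriesTerm Q g (suc k) ≋ seriesTerm (quotD Q) (D g) k
    Dⁿ-suc-term k = ≡⇒≋ (≡.cong (scale (Q (suc k))) (Dⁿ-suc k g))

  ⟦⟧-congruent : ∀ s → Congruent ⟦ s ⟧
  ⟦⟧-congruent s .≋-cong = ⟦⟧-cong s

  ⟦⟧-shiftInvariant : ∀ s → ShiftInvariant ⟦ s ⟧
  ⟦⟧-shiftInvariant s .E-comm = ⟦⟧-E s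

  -- The coefficient of x in Q x computes to Q 0 * 1#.
  IsDelta⇒constantTerm≈0 : ∀ {Q} → IsDelta Q → Q 0 ≈ 0#
  IsDelta⇒constantTerm≈0 (_ , _ , Qx≈k) = trans (sym (*-identityʳ _)) (Qx≈k 1)

  IsInverse⇒inverseʳ : ∀ {A B} → IsInverse A B → ∀ f → ⟦ A ⟧ (⟦ B ⟧ f) ≋ f
  IsInverse⇒inverseʳ (AB≈id , _) f = mk≋ (AB≈id f)

  IsInverse⇒inverseˡ : ∀ {A B} → IsInverse A B → ∀ f → ⟦ B ⟧ (⟦ A ⟧ f) ≋ f
  IsInverse⇒inverseˡ (_ , BA≈id) f = mk≋ (BA≈id f)

  module _ {M S : Op} (σ : IsSigma M S) where
    open IsSigma σ

    IsSigma⇒congruent : Congruent S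
    IsSigma⇒congruent .≋-cong {f} {g} (mk≋ f≈g) = mk≋ (IsLinear.cong linear f g f≈g)

    IsSigma⇒rightInverse : ∀ h → M (S h) ≋ h
    IsSigma⇒rightInverse h = mk≋ (right h)

    -- S M = 1 - 𝓔₀ applied to S h, with M S h = h, says that S h - (S h)(0) = S h.
    IsSigma⇒eval0≈0 : ∀ h → eval (S h) 0# ≈ 0#
    IsSigma⇒eval0≈0 h = ⁻¹-injective (trans (sym (-1*x≈-x e)) (trans -1*e≈0 (sym ε⁻¹≈ε)))
      where
      e = eval (S h) 0#
      constantTerm : coeff (S h) 0 + - 1# * e ≈ coeff (S h) 0
      constantTerm = begin
        coeff (S h) 0 + - 1# * e                ≈⟨ coeff-+ₚ (S h) (scale (- 1#) (const e)) 0 ⟨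
        coeff (S h +ₚ scale (- 1#) (const e)) 0 ≈⟨ left (S h) 0 ⟨
        coeff (S (M (S h))) 0                   ≈⟨ coeff-≈ (≋-cong IsSigma⇒congruent (IsSigma⇒rightInverse h)) 0 ⟩
        coeff (S h) 0                           ∎
        where open ≈-Reasoning
      -1*e≈0 : - 1# * e ≈ 0#
      -1*e≈0 = identityʳ-unique _ _ constantTerm

    IsSigma-unique : (T : Op) → (∀ h → M (T h) ≋ h) → (∀ h → eval (T h) 0# ≈ 0#) → ∀ h → S h ≋ T h
    IsSigma-unique T MT≋id T0≈0 h = begin
      S h                                   ≈⟨ ≋-cong IsSigma⇒congruent (MT≋id h) ⟨
      S (M (T h))                           ≈⟨ mk≋ (left (T h)) ⟩
      T h +ₚ const (- 1# * eval (T h) 0#)   ≈⟨ +ₚ-const≈0 (T h) (trans (*-congˡ (T0≈0 h)) (zeroʳ _)) ⟩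
      T h                                   ∎
      where open ≋-Reasoning

  module _ (a : K) where

    conj-cong : ∀ {S T} → (∀ f → S f ≋ T f) → ∀ f → conj a S f ≋ conj a T f
    conj-cong S≋T f = E-cong (- a) (S≋T (E a f))

    conj-∘ʳ : ∀ {S T} → Congruent S → ShiftInvariant T → ∀ f → conj a (S ∘ T) f ≋ conj a S (T f)
    conj-∘ʳ S-cong T-inv f = E-cong (- a) (≋-cong S-cong (E-comm T-inv a f))

    conj-∘ˡ : ∀ {S T} → ShiftInvariant T → ∀ f → T (conj a S f) ≋ conj a (T ∘ S) f
    conj-∘ˡ {S} T-inv f = E-comm T-inv (- a) (S (E a f))

    conj-shiftInvariant : ∀ {T} → ShiftInvariant T → ∀ f → conj a T f ≋ T f
    conj-shiftInvariant {T} T-inv f = ≋-trans (E-cong (- a) (E-comm T-inv a f)) (E-inverse a (T f))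

  𝓔-conj-sigma : ∀ {M S} → IsSigma M S → ∀ a → (𝓔 a ∘ conj a S) ≈ₒ 0ₒ
  𝓔-conj-sigma {S = S} σ a f zero    = begin
    eval (E (- a) (S (E a f))) a ≈⟨ eval-E (- a) (S (E a f)) a ⟩
    eval (S (E a f)) (a + - a)   ≈⟨ eval-cong (S (E a f)) (-‿inverseʳ a) ⟩
    eval (S (E a f)) 0#          ≈⟨ IsSigma⇒eval0≈0 σ (E a f) ⟩
    0#                           ∎
    where open ≈-Reasoning
  𝓔-conj-sigma σ a f (suc n) = refl

  sigma-∘-Appell : ∀ {M S A Ainv AS} → IsSigma M S → IsInverse A Ainv → IsSigma (⟦ A ⟧ ∘ M) AS →
                   ∀ f → AS f ≋ S (⟦ Ainv ⟧ f)
  sigma-∘-Appell {M} {S} {A} {Ainv} σ A⁻¹ σA =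
    IsSigma-unique σA (S ∘ ⟦ Ainv ⟧) AMSAinv≋id (IsSigma⇒eval0≈0 σ ∘ ⟦ Ainv ⟧)
    where
    AMSAinv≋id : ∀ h → ⟦ A ⟧ (M (S (⟦ Ainv ⟧ h))) ≋ h
    AMSAinv≋id h = ≋-trans (⟦⟧-cong A (IsSigma⇒rightInverse σ (⟦ Ainv ⟧ h))) (IsInverse⇒inverseʳ A⁻¹ h)

  conj-sigma-∘-Appell : ∀ {M S A Ainv AS} → IsSigma M S → IsInverse A Ainv → IsSigma (⟦ A ⟧ ∘ M) AS →
                        ∀ a → conj a AS ≈ₒ (conj a S ∘ ⟦ Ainv ⟧)
  conj-sigma-∘-Appell {Ainv = Ainv} σ A⁻¹ σA a f = coeff-≈ (≋-trans
    (conj-cong a (sigma-∘-Appell σ A⁻¹ σA) f)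
    (conj-∘ʳ a (IsSigma⇒congruent σ) (⟦⟧-shiftInvariant Ainv) f))

  divide-shiftInvariant : ∀ Q Sinv → ShiftInvariant (divide Q Sinv)
  divide-shiftInvariant Q Sinv =
    ShiftInvariant-∘ (⟦⟧-congruent (quotD Q)) (⟦⟧-shiftInvariant (quotD Q)) (⟦⟧-shiftInvariant Sinv)

  module _ {R Rinv Sinv} (R0≈0 : R 0 ≈ 0#) (σR : IsSigma ⟦ R ⟧ Rinv) (S⁻¹ : IsInverse (quotD R) Sinv) where

    D-sigma≋quotD-inverse : ∀ h → D (Rinv h) ≋ ⟦ Sinv ⟧ h
    D-sigma≋quotD-inverse h = begin
      D (Rinv h)                          ≈⟨ IsInverse⇒inverseˡ S⁻¹ (D (Rinv h)) ⟨
      ⟦ Sinv ⟧ (⟦ quotD R ⟧ (D (Rinv h))) ≈⟨ ⟦⟧-cong Sinv (⟦⟧-quotD R R0≈0 (Rinv h)) ⟨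
      ⟦ Sinv ⟧ (⟦ R ⟧ (Rinv h))           ≈⟨ ⟦⟧-cong Sinv (IsSigma⇒rightInverse σR h) ⟩
      ⟦ Sinv ⟧ h                          ∎
      where open ≋-Reasoning

    delta-∘-sigma≋divide : ∀ {Q} → Q 0 ≈ 0# → ∀ f → ⟦ Q ⟧ (Rinv f) ≋ divide Q Sinv f
    delta-∘-sigma≋divide {Q} Q0≈0 f =
      ≋-trans (⟦⟧-quotD Q Q0≈0 (Rinv f)) (⟦⟧-cong (quotD Q) (D-sigma≋quotD-inverse f))

    divide≈delta-∘-sigma : ∀ {Q} → Q 0 ≈ 0# → divide Q Sinv ≈ₒ (⟦ Q ⟧ ∘ Rinv)
    divide≈delta-∘-sigma Q0≈0 f = coeff-≈ (≋-sym (delta-∘-sigma≋divide Q0≈0 f))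

    divide≈delta-∘-conj-sigma : ∀ {Q} → Q 0 ≈ 0# → ∀ a → divide Q Sinv ≈ₒ (⟦ Q ⟧ ∘ conj a Rinv)
    divide≈delta-∘-conj-sigma {Q} Q0≈0 a f = coeff-≈ (begin
      divide Q Sinv f           ≈⟨ conj-shiftInvariant a (divide-shiftInvariant Q Sinv) f ⟨
      conj a (divide Q Sinv) f  ≈⟨ conj-cong a (delta-∘-sigma≋divide Q0≈0) f ⟨
      conj a (⟦ Q ⟧ ∘ Rinv) f   ≈⟨ conj-∘ˡ a {Rinv} (⟦⟧-shiftInvariant Q) f ⟨
      ⟦ Q ⟧ (conj a Rinv f)     ∎)
      where open ≋-Reasoning

    module _ {Q Qinv Pinv} (Q0≈0 : Q 0 ≈ 0#) (σQ : IsSigma ⟦ Q ⟧ Qinv) (P⁻¹ : IsInverse (quotD Q) Pinv) where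

      sigma≈sigma-∘-divide : ∀ f → Qinv f ≋ Rinv (divide R Pinv f)
      sigma≈sigma-∘-divide =
        IsSigma-unique σQ (Rinv ∘ divide R Pinv) QRinvRP⁻¹≋id (IsSigma⇒eval0≈0 σR ∘ divide R Pinv)
        where
        QRinvRP⁻¹≋id : ∀ h → ⟦ Q ⟧ (Rinv (divide R Pinv h)) ≋ h
        QRinvRP⁻¹≋id h = begin
          ⟦ Q ⟧ (Rinv (divide R Pinv h))
            ≈⟨ delta-∘-sigma≋divide Q0≈0 (divide R Pinv h) ⟩
          ⟦ quotD Q ⟧ (⟦ Sinv ⟧ (⟦ quotD R ⟧ (⟦ Pinv ⟧ h)))
            ≈⟨ ⟦⟧-cong (quotD Q) (IsInverse⇒inverseˡ S⁻¹ (⟦ Pinv ⟧ h)) ⟩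
          ⟦ quotD Q ⟧ (⟦ Pinv ⟧ h)
            ≈⟨ IsInverse⇒inverseʳ P⁻¹ h ⟩
          h
            ∎
          where open ≋-Reasoning

      conj-sigma≈conj-sigma-∘-divide : ∀ a → conj a Qinv ≈ₒ (conj a Rinv ∘ divide R Pinv)
      conj-sigma≈conj-sigma-∘-divide a f = coeff-≈ (≋-trans
        (conj-cong a sigma≈sigma-∘-divide f)
        (conj-∘ʳ a (IsSigma⇒congruent σR) (divide-shiftInvariant R Pinv) f))

-- Characteristic zero is what makes sigma operators exist; here they are given.
mainTheorem11 : ∀ {c ℓ : Level} (F : Field c ℓ) → Umbral.CharZero F →
    let open Umbral F in
    (Q R : Series) → IsDelta Q → IsDelta R → (a : K) →
    (Qinv Rinv : Op) → IsSigma ⟦ Q ⟧ Qinv → IsSigma ⟦ R ⟧ Rinv →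
    -- Pinv, Sinv : inverses of P, S where Q = D P, R = D S
    (Pinv Sinv : Series) → IsInverse (quotD Q) Pinv → IsInverse (quotD R) Sinv →
    -- (a)
    ((𝓔 a ∘ conj a Qinv) ≈ₒ 0ₒ)
    -- (b)
    × ((A Ainv : Series) → IsInverse A Ainv →
        (AQinv : Op) → IsSigma (⟦ A ⟧ ∘ ⟦ Q ⟧) AQinv →
        conj a AQinv ≈ₒ (conj a Qinv ∘ ⟦ Ainv ⟧))
    -- (c)
    × (conj a Qinv ≈ₒ (conj a Rinv ∘ divide R Pinv))
    -- (d)
    × ((divide Q Sinv ≈ₒ (⟦ Q ⟧ ∘ conj a Rinv))
       × (divide Q Sinv ≈ₒ (⟦ Q ⟧ ∘ Rinv)))
mainTheorem11 F _ Q R δQ δR a Qinv Rinv σQ σR Pinv Sinv P⁻¹ S⁻¹ =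
    𝓔-conj-sigma σQ a
  , (λ A Ainv A⁻¹ AQinv σAQ → conj-sigma-∘-Appell σQ A⁻¹ σAQ a)
  , conj-sigma≈conj-sigma-∘-divide R0≈0 σR S⁻¹ Q0≈0 σQ P⁻¹ a
  , divide≈delta-∘-conj-sigma R0≈0 σR S⁻¹ Q0≈0 a
  , divide≈delta-∘-sigma R0≈0 σR S⁻¹ Q0≈0
  where
  open UmbralProperties F
  Q0≈0 = IsDelta⇒constantTerm≈0 {Q} δQ
  R0≈0 = IsDelta⇒constantTerm≈0 {R} δR
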